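{- Let $\tau$ be a rooted tree, let $\mathcal R_\tau=\{b(v):v\in\tau\}$ be the multiset of branch numbers and $\mathcal D_\tau=\{d(v):v\in\tau\}$ the multiset of distance numbers. Then $\mathcal R_\tau$ majorizes $\mathcal D_\tau$.
   Context: A rooted tree $\tau$ is a finite tree with a distinguished root vertex $R$. For a vertex $v$, $b(v)$ is the number of vertices $w$ (including $v$) such that $v$ lies on the path from $w$ to $R$; $d(v)$ is the number of vertices on the shortest path from $v$ to $R$, including both endpoints. Majorization: for two multisets $\mathcal A,\mathcal B$ of $n$ real numbers, let $a_1\ge\dots\ge a_n$ and $b_1\ge\dots\ge b_n$ be their elements in non-increasing order. $\mathcal A$ majorizes $\mathcal B$ if $a_1+\dots+a_k\ge b_1+\dots+b_k$ for all $1\le k<n$ and $a_1+\dots+a_n=b_1+\dots+b_n$. -}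

module Defs where

open import Data.Nat using (ℕ; zero; suc; _+_; _≤_; _<_; _≥_)
open import Data.List using (List; []; _∷_; _++_; map; take; length)
open import Data.Nat.ListAction using (sum)
open import Data.List.Relation.Unary.Linked using (Linked)
open import Data.List.Relation.Binary.Permutation.Propositional using (_↭_)
open import Data.Product using (_×_)
open import Relation.Binary.PropositionalEquality using (_≡_)

-- Every finite rooted tree is represented
-- (the order of children is irrelevant for the multisets below).
data Tree : Set where
  node : List Tree → Tree

mutual
  size : Tree → ℕ
  size (node ts) = suc (sizes ts)

  sizes : List Tree → ℕ
  sizes []       = 0
  sizes (t ∷ ts) = size t + sizes ts

mutual
  branchNumbers : Tree → List ℕ
  branchNumbers (node ts) = size (node ts) ∷ branchNumbersF ts

  branchNumbersF : List Tree → List ℕ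
  branchNumbersF []       = []
  branchNumbersF (t ∷ ts) = branchNumbers t ++ branchNumbersF ts

mutual
  -- distance numbers of a tree whose root has distance number k:
  -- d(v) = number of vertices on the path from v to the root R
  distancesFrom : ℕ → Tree → List ℕ
  distancesFrom k (node ts) = k ∷ distancesFromF (suc k) ts

  distancesFromF : ℕ → List Tree → List ℕ
  distancesFromF k []       = []
  distancesFromF k (t ∷ ts) = distancesFrom k t ++ distancesFromF k ts

distanceNumbers : Tree → List ℕ
distanceNumbers = distancesFrom 1

NonIncreasing : List ℕ → Set
NonIncreasing = Linked _≥_

Majorizes : List ℕ → List ℕ → Set
Majorizes A B =
  length A ≡ length B ×
  (∀ (a b : List ℕ) → a ↭ A → NonIncreasing a → b ↭ B → NonIncreasing b →
     (∀ k → 1 ≤ k → k < length a → sum (take k a) ≥ sum (take k b)) ×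
     sum a ≡ sum b)

module Submission where

-- Write top k L for the largest sum of at most k entries of L.  It does not
-- depend on the order of L, and on a non-increasing list it is the sum of the
-- first k entries, so A majorizes a list B of the same length and sum as soon
-- as top k B ≤ top k A for every k.  Both sums count the pairs (v , w) with w
-- on the path from v to R.
-- The inequalities are proved by induction on the tree: the branch numbers of
-- a tree with n vertices are n together with those of the subtrees, and its
-- distance numbers are 1 together with those of the subtrees raised by one.
-- Raising k + 1 chosen entries by one is paid for by n thanks to the only
-- global fact needed: in a forest with n vertices the (k+1)-st largest
-- distance number d is at most n − k, since k + 1 vertices have depth at least
-- d and one of them has d − 1 ancestors of smaller depth.

open import Defs
import Algebra.Properties.CommutativeSemigroup as CommutativeSemigroupProperties
open import Data.Nat using (ℕ; zero; suc; _+_; _≤_; _≥_; _⊔_; _⊓_; z≤n; s≤s)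
open import Data.Nat.Properties
open import Data.Nat.Tactic.RingSolver using (solve-∀)
open import Data.Nat.ListAction using (sum)
open import Data.Nat.ListAction.Properties using (sum-++; sum-↭)
open import Data.List using (List; []; _∷_; _++_; map; take; length)
open import Data.List.Properties using (map-++; length-map; length-++)
open import Data.List.Relation.Unary.Linked using (_∷_; tail)
open import Data.List.Relation.Binary.Permutation.Propositional as ↭ using (_↭_; ↭-sym)
open import Data.Product using (Σ-syntax; _×_; _,_)
open import Data.Sum using (inj₁; inj₂)
open import Relation.Nullary using (yes; no)
open import Relation.Binary.PropositionalEquality
  using (_≡_; refl; sym; trans; cong; cong₂; subst; module ≡-Reasoning)

private
  module ⊔ = CommutativeSemigroupProperties ⊔-commutativeSemigroup
  module + = CommutativeSemigroupProperties +-commutativeSemigroup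

top : ℕ → List ℕ → ℕ
top zero    _       = 0
top (suc k) []      = 0
top (suc k) (x ∷ L) = (x + top k L) ⊔ top (suc k) L

top-[] : ∀ k → top k [] ≡ 0
top-[] zero    = refl
top-[] (suc k) = refl

top-≤-∷ : ∀ k x L → top k L ≤ top k (x ∷ L)
top-≤-∷ zero    x L = z≤n
top-≤-∷ (suc k) x L = m≤n⊔m _ _

top-mono-≤ : ∀ {j k} → j ≤ k → ∀ L → top j L ≤ top k L
top-mono-≤ z≤n       _       = z≤n
top-mono-≤ (s≤s j≤k) []      = z≤n
top-mono-≤ (s≤s j≤k) (x ∷ L) =
  ⊔-mono-≤ (+-monoʳ-≤ x (top-mono-≤ j≤k L)) (top-mono-≤ (s≤s j≤k) L)

top-length : ∀ {k} L → length L ≤ k → top k L ≡ sum L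
top-length {k}     []      _         = top-[] k
top-length {suc k} (x ∷ L) (s≤s n≤k) = begin
  (x + top k L) ⊔ top (suc k) L
    ≡⟨ cong₂ _⊔_ (cong (x +_) (top-length L n≤k)) (top-length L (m≤n⇒m≤1+n n≤k)) ⟩
  (x + sum L) ⊔ sum L
    ≡⟨ m≥n⇒m⊔n≡m (m≤n+m (sum L) x) ⟩
  x + sum L ∎
  where open ≡-Reasoning

top-map-suc : ∀ k L → top k (map suc L) ≡ k ⊓ length L + top k L
top-map-suc zero    L       = refl
top-map-suc (suc k) []      = refl
top-map-suc (suc k) (x ∷ L) rewrite top-map-suc k L | top-map-suc (suc k) L
  with length L ≤? k
... | yes n≤k
  rewrite m≥n⇒m⊓n≡n n≤k | m≥n⇒m⊓n≡n (m≤n⇒m≤1+n n≤k)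
        | top-length L n≤k | top-length L (m≤n⇒m≤1+n n≤k) = begin
  (suc x + (n + sum L)) ⊔ (n + sum L)  ≡⟨ m≥n⇒m⊔n≡m (m≤n+m (n + sum L) (suc x)) ⟩
  suc (x + (n + sum L))                ≡⟨ cong suc (+.x∙yz≈y∙xz x n (sum L)) ⟩
  suc (n + (x + sum L))                ≡⟨ cong (suc n +_) (sym (m≥n⇒m⊔n≡m (m≤n+m (sum L) x))) ⟩
  suc n + ((x + sum L) ⊔ sum L)        ∎
  where
  open ≡-Reasoning
  n = length L
... | no n≰k
  rewrite m≤n⇒m⊓n≡m (<⇒≤ (≰⇒> n≰k)) | m≤n⇒m⊓n≡m (≰⇒> n≰k) = begin
  (suc x + (k + top k L)) ⊔ (suc k + top (suc k) L)
    ≡⟨ cong (_⊔ (suc k + top (suc k) L)) (cong suc (+.x∙yz≈y∙xz x k (top k L))) ⟩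
  (suc k + (x + top k L)) ⊔ (suc k + top (suc k) L)
    ≡⟨ sym (+-distribˡ-⊔ (suc k) (x + top k L) (top (suc k) L)) ⟩
  suc k + ((x + top k L) ⊔ top (suc k) L) ∎
  where open ≡-Reasoning

top-map-suc-≤ : ∀ k L → top k (map suc L) ≤ length L + top k L
top-map-suc-≤ k L = begin
  top k (map suc L)         ≡⟨ top-map-suc k L ⟩
  k ⊓ length L + top k L    ≤⟨ +-monoˡ-≤ (top k L) (m⊓n≤n k (length L)) ⟩
  length L + top k L        ∎
  where open ≤-Reasoning

top-++-≥ : ∀ i j A B → top i A + top j B ≤ top (i + j) (A ++ B)
top-++-≥ i       j []      B rewrite top-[] i = top-mono-≤ (m≤n+m j i) B
top-++-≥ zero    j (x ∷ A) B = ≤-trans (top-++-≥ zero j A B) (top-≤-∷ j x (A ++ B))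
top-++-≥ (suc i) j (x ∷ A) B = begin
  ((x + top i A) ⊔ top (suc i) A) + top j B
    ≡⟨ +-distribʳ-⊔ (top j B) (x + top i A) (top (suc i) A) ⟩
  (x + top i A + top j B) ⊔ (top (suc i) A + top j B)
    ≡⟨ cong (_⊔ (top (suc i) A + top j B)) (+-assoc x (top i A) (top j B)) ⟩
  (x + (top i A + top j B)) ⊔ (top (suc i) A + top j B)
    ≤⟨ ⊔-mono-≤ (+-monoʳ-≤ x (top-++-≥ i j A B)) (top-++-≥ (suc i) j A B) ⟩
  (x + top (i + j) (A ++ B)) ⊔ top (suc i + j) (A ++ B) ∎
  where open ≤-Reasoning

top-++-split : ∀ k A B →
  Σ[ i ∈ ℕ ] Σ[ j ∈ ℕ ] i + j ≡ k × top k (A ++ B) ≤ top i A + top j B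
top-++-split k       []      B = 0 , k , refl , ≤-refl
top-++-split zero    (x ∷ A) B = 0 , 0 , refl , z≤n
top-++-split (suc k) (x ∷ A) B
  with ⊔-sel (x + top k (A ++ B)) (top (suc k) (A ++ B))
... | inj₁ takes-x with top-++-split k A B
...   | i , j , refl , split = suc i , j , refl , (begin
  top (suc k) (x ∷ A ++ B)      ≡⟨ takes-x ⟩
  x + top k (A ++ B)            ≤⟨ +-monoʳ-≤ x split ⟩
  x + (top i A + top j B)       ≡⟨ +-assoc x (top i A) (top j B) ⟨
  x + top i A + top j B         ≤⟨ +-monoˡ-≤ (top j B) (m≤m⊔n _ _) ⟩
  top (suc i) (x ∷ A) + top j B ∎)
  where open ≤-Reasoning
top-++-split (suc k) (x ∷ A) B
    | inj₂ skips-x with top-++-split (suc k) A B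
...   | i , j , i+j≡k , split = i , j , i+j≡k , (begin
  top (suc k) (x ∷ A ++ B)      ≡⟨ skips-x ⟩
  top (suc k) (A ++ B)          ≤⟨ split ⟩
  top i A + top j B             ≤⟨ +-monoˡ-≤ (top j B) (top-≤-∷ i x A) ⟩
  top i (x ∷ A) + top j B       ∎)
  where open ≤-Reasoning

top-∷-cong : ∀ x {L L'} → (∀ k → top k L ≡ top k L') → ∀ k → top k (x ∷ L) ≡ top k (x ∷ L')
top-∷-cong x eq zero    = refl
top-∷-cong x eq (suc k) = cong₂ _⊔_ (cong (x +_) (eq k)) (eq (suc k))

top-∷-∷ : ∀ k x y L → top (suc (suc k)) (x ∷ y ∷ L) ≡
  (x + (y + top k L)) ⊔ ((x + top (suc k) L) ⊔ ((y + top (suc k) L) ⊔ top (suc (suc k)) L))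
top-∷-∷ k x y L = trans
  (cong (_⊔ top (suc (suc k)) (y ∷ L)) (+-distribˡ-⊔ x (y + top k L) (top (suc k) L)))
  (⊔-assoc (x + (y + top k L)) (x + top (suc k) L) (top (suc (suc k)) (y ∷ L)))

top-swap : ∀ k x y L → top k (x ∷ y ∷ L) ≡ top k (y ∷ x ∷ L)
top-swap zero          x y L = refl
top-swap (suc zero)    x y L = ⊔.x∙yz≈y∙xz (x + 0) (y + 0) (top 1 L)
top-swap (suc (suc k)) x y L = begin
  top (suc (suc k)) (x ∷ y ∷ L)
    ≡⟨ top-∷-∷ k x y L ⟩
  (x + (y + top k L)) ⊔ ((x + top (suc k) L) ⊔ ((y + top (suc k) L) ⊔ top (suc (suc k)) L))
    ≡⟨ cong₂ _⊔_ (+.x∙yz≈y∙xz x y (top k L))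
                 (⊔.x∙yz≈y∙xz (x + top (suc k) L) (y + top (suc k) L) (top (suc (suc k)) L)) ⟩
  (y + (x + top k L)) ⊔ ((y + top (suc k) L) ⊔ ((x + top (suc k) L) ⊔ top (suc (suc k)) L))
    ≡⟨ top-∷-∷ k y x L ⟨
  top (suc (suc k)) (y ∷ x ∷ L) ∎
  where open ≡-Reasoning

top-↭ : ∀ {L L'} → L ↭ L' → ∀ k → top k L ≡ top k L'
top-↭ ↭.refl          k = refl
top-↭ (↭.prep x p)    k = top-∷-cong x (top-↭ p) k
top-↭ (↭.swap x y p)  k = trans (top-swap k x y _) (top-∷-cong y (top-∷-cong x (top-↭ p)) k)
top-↭ (↭.trans p q)   k = trans (top-↭ p k) (top-↭ q k)

top-suc-≤-head : ∀ {x L} k → NonIncreasing (x ∷ L) → top (suc k) L ≤ x + top k L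
top-suc-≤-head {L = []}    k _           = z≤n
top-suc-≤-head {x} {y ∷ L} k (y≤x ∷ sorted) = begin
  (y + top k L) ⊔ top (suc k) L ≤⟨ ⊔-lub (+-monoˡ-≤ (top k L) y≤x)
                                        (≤-trans (top-suc-≤-head k sorted) (+-monoˡ-≤ (top k L) y≤x)) ⟩
  x + top k L                   ≤⟨ +-monoʳ-≤ x (top-≤-∷ k y L) ⟩
  x + top k (y ∷ L)             ∎
  where open ≤-Reasoning

top≡sum-take : ∀ {L} → NonIncreasing L → ∀ k → top k L ≡ sum (take k L)
top≡sum-take {L}     _      zero    = refl
top≡sum-take {[]}    _      (suc k) = refl
top≡sum-take {x ∷ L} sorted (suc k) = begin
  (x + top k L) ⊔ top (suc k) L  ≡⟨ m≥n⇒m⊔n≡m (top-suc-≤-head k sorted) ⟩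
  x + top k L                    ≡⟨ cong (x +_) (top≡sum-take (tail sorted) k) ⟩
  x + sum (take k L)             ∎
  where open ≡-Reasoning

WeaklyMajorizes : List ℕ → List ℕ → Set
WeaklyMajorizes A B = ∀ k → top k B ≤ top k A

weaklyMajorizes-++ : ∀ {A A' B B'} → WeaklyMajorizes A A' → WeaklyMajorizes B B' →
                     WeaklyMajorizes (A ++ B) (A' ++ B')
weaklyMajorizes-++ {A} {A'} {B} {B'} A≽A' B≽B' k with top-++-split k A' B'
... | i , j , refl , split =
  ≤-trans split (≤-trans (+-mono-≤ (A≽A' i) (B≽B' j)) (top-++-≥ i j A B))

weaklyMajorizes⇒majorizes : ∀ {A B} → length A ≡ length B → sum A ≡ sum B →
                            WeaklyMajorizes A B → Majorizes A B
weaklyMajorizes⇒majorizes {A} {B} |A|≡|B| ΣA≡ΣB A≽B =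
  |A|≡|B| , λ a b a↭A a↓ b↭B b↓ → (λ k _ _ → prefix a b a↭A a↓ b↭B b↓ k) ,
    trans (sum-↭ a↭A) (trans ΣA≡ΣB (sym (sum-↭ b↭B)))
  where
  prefix : ∀ a b → a ↭ A → NonIncreasing a → b ↭ B → NonIncreasing b →
           ∀ k → sum (take k a) ≥ sum (take k b)
  prefix a b a↭A a↓ b↭B b↓ k = begin
    sum (take k b)  ≡⟨ top≡sum-take b↓ k ⟨
    top k b         ≡⟨ top-↭ b↭B k ⟩
    top k B         ≤⟨ A≽B k ⟩
    top k A         ≡⟨ top-↭ (↭-sym a↭A) k ⟩
    top k a         ≡⟨ top≡sum-take a↓ k ⟩
    sum (take k a)  ∎
    where open ≤-Reasoning

-- Equivalently, the (k+1)-st largest entry of L is at most length L − k.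
RankBounded : List ℕ → Set
RankBounded L = ∀ k → top (suc k) (map suc L) ≤ suc (length L) + top k L

rankBounded-++ : ∀ {A B} → RankBounded A → RankBounded B → RankBounded (A ++ B)
rankBounded-++ {A} {B} bA bB k rewrite map-++ suc A B | length-++ A {B}
  with top-++-split (suc k) (map suc A) (map suc B)
... | zero , j , refl , split =
  ≤-trans split (≤-trans (bB k) (+-mono-≤ (s≤s (m≤n+m _ _)) (top-++-≥ 0 k A B)))
... | suc i , j , refl , split = begin
  top (suc (i + j)) (map suc A ++ map suc B)       ≤⟨ split ⟩
  top (suc i) (map suc A) + top j (map suc B)      ≤⟨ +-mono-≤ (bA i) (top-map-suc-≤ j B) ⟩
  suc (length A) + top i A + (length B + top j B)  ≡⟨ regroup (length A) (top i A) (length B) (top j B) ⟩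
  suc (length A + length B) + (top i A + top j B)  ≤⟨ +-monoʳ-≤ _ (top-++-≥ i j A B) ⟩
  suc (length A + length B) + top (i + j) (A ++ B) ∎
  where
  open ≤-Reasoning
  regroup : ∀ a b c d → suc a + b + (c + d) ≡ suc (a + c) + (b + d)
  regroup = solve-∀

rankBounded-root : ∀ {L} → RankBounded L → RankBounded (1 ∷ map suc L)
rankBounded-root {L} bL k = ⊔-lub (s≤s (s≤s throughRoot)) avoidingRoot
  where
  open ≤-Reasoning
  M = map suc L
  n = length L
  |M|≡n : length M ≡ n
  |M|≡n = length-map suc L

  throughRoot : top k (map suc M) ≤ length M + top k (1 ∷ M)
  throughRoot = ≤-trans (top-map-suc-≤ k M) (+-monoʳ-≤ (length M) (top-≤-∷ k 1 M))

  regroup : ∀ a b c → suc a + (suc b + c) ≡ suc (suc b) + (a + c)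
  regroup = solve-∀

  avoidingRoot : top (suc k) (map suc M) ≤ suc (suc (length M)) + top k (1 ∷ M)
  avoidingRoot = begin
    top (suc k) (map suc M)              ≡⟨ top-map-suc (suc k) M ⟩
    suc k ⊓ length M + top (suc k) M     ≡⟨ cong (λ m → suc k ⊓ m + top (suc k) M) |M|≡n ⟩
    suc k ⊓ n + top (suc k) M            ≤⟨ +-mono-≤ (⊓-monoʳ-≤ (suc k) (n≤1+n n)) (bL k) ⟩
    suc (k ⊓ n) + (suc n + top k L)      ≡⟨ regroup (k ⊓ n) n (top k L) ⟩
    suc (suc n) + (k ⊓ n + top k L)      ≡⟨ cong (suc (suc n) +_) (top-map-suc k L) ⟨
    suc (suc n) + top k M                ≤⟨ +-monoʳ-≤ (suc (suc n)) (top-≤-∷ k 1 M) ⟩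
    suc (suc n) + top k (1 ∷ M)          ≡⟨ cong (λ m → suc (suc m) + top k (1 ∷ M)) |M|≡n ⟨
    suc (suc (length M)) + top k (1 ∷ M) ∎

mutual
  distancesFrom-suc : ∀ k t → distancesFrom (suc k) t ≡ map suc (distancesFrom k t)
  distancesFrom-suc k (node ts) = cong (suc k ∷_) (distancesFromF-suc (suc k) ts)

  distancesFromF-suc : ∀ k ts → distancesFromF (suc k) ts ≡ map suc (distancesFromF k ts)
  distancesFromF-suc k []       = refl
  distancesFromF-suc k (t ∷ ts) = trans
    (cong₂ _++_ (distancesFrom-suc k t) (distancesFromF-suc k ts))
    (sym (map-++ suc (distancesFrom k t) (distancesFromF k ts)))

distanceNumbers-node : ∀ ts → distanceNumbers (node ts) ≡ 1 ∷ map suc (distancesFromF 1 ts)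
distanceNumbers-node ts = cong (1 ∷_) (distancesFromF-suc 1 ts)

mutual
  length-distancesFrom : ∀ k t → length (distancesFrom k t) ≡ size t
  length-distancesFrom k (node ts) = cong suc (length-distancesFromF (suc k) ts)

  length-distancesFromF : ∀ k ts → length (distancesFromF k ts) ≡ sizes ts
  length-distancesFromF k []       = refl
  length-distancesFromF k (t ∷ ts) = trans (length-++ (distancesFrom k t))
    (cong₂ _+_ (length-distancesFrom k t) (length-distancesFromF k ts))

mutual
  length-branchNumbers : ∀ t → length (branchNumbers t) ≡ size t
  length-branchNumbers (node ts) = cong suc (length-branchNumbersF ts)

  length-branchNumbersF : ∀ ts → length (branchNumbersF ts) ≡ sizes ts
  length-branchNumbersF []       = refl
  length-branchNumbersF (t ∷ ts) = trans (length-++ (branchNumbers t))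
    (cong₂ _+_ (length-branchNumbers t) (length-branchNumbersF ts))

sum-map-suc : ∀ L → sum (map suc L) ≡ length L + sum L
sum-map-suc []      = refl
sum-map-suc (x ∷ L) =
  cong suc (trans (cong (x +_) (sum-map-suc L)) (+.x∙yz≈y∙xz x (length L) (sum L)))

mutual
  sum-branchNumbers≡sum-distanceNumbers : ∀ t → sum (branchNumbers t) ≡ sum (distanceNumbers t)
  sum-branchNumbers≡sum-distanceNumbers (node ts) = begin
    suc (sizes ts + sum (branchNumbersF ts))
      ≡⟨ cong suc (cong₂ _+_ (sym (length-distancesFromF 1 ts)) (sum-branchNumbersF≡sum-distancesFromF ts)) ⟩
    suc (length U + sum U)    ≡⟨ cong suc (sum-map-suc U) ⟨
    sum (1 ∷ map suc U)       ≡⟨ cong sum (distanceNumbers-node ts) ⟨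
    sum (distanceNumbers (node ts)) ∎
    where
    open ≡-Reasoning
    U = distancesFromF 1 ts

  sum-branchNumbersF≡sum-distancesFromF : ∀ ts → sum (branchNumbersF ts) ≡ sum (distancesFromF 1 ts)
  sum-branchNumbersF≡sum-distancesFromF []       = refl
  sum-branchNumbersF≡sum-distancesFromF (t ∷ ts) = begin
    sum (branchNumbers t ++ branchNumbersF ts)
      ≡⟨ sum-++ (branchNumbers t) (branchNumbersF ts) ⟩
    sum (branchNumbers t) + sum (branchNumbersF ts)
      ≡⟨ cong₂ _+_ (sum-branchNumbers≡sum-distanceNumbers t) (sum-branchNumbersF≡sum-distancesFromF ts) ⟩
    sum (distanceNumbers t) + sum (distancesFromF 1 ts)
      ≡⟨ sum-++ (distanceNumbers t) (distancesFromF 1 ts) ⟨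
    sum (distanceNumbers t ++ distancesFromF 1 ts) ∎
    where open ≡-Reasoning

mutual
  distanceNumbers-rankBounded : ∀ t → RankBounded (distanceNumbers t)
  distanceNumbers-rankBounded (node ts) =
    subst RankBounded (sym (distanceNumbers-node ts)) (rankBounded-root (distancesFromF-rankBounded ts))

  distancesFromF-rankBounded : ∀ ts → RankBounded (distancesFromF 1 ts)
  distancesFromF-rankBounded []       k = z≤n
  distancesFromF-rankBounded (t ∷ ts) =
    rankBounded-++ (distanceNumbers-rankBounded t) (distancesFromF-rankBounded ts)

mutual
  branchNumbers-weaklyMajorizes : ∀ t → WeaklyMajorizes (branchNumbers t) (distanceNumbers t)
  branchNumbers-weaklyMajorizes (node ts) zero    = z≤n
  branchNumbers-weaklyMajorizes (node ts) (suc k) = begin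
    top (suc k) (distanceNumbers (node ts))
      ≡⟨ cong (top (suc k)) (distanceNumbers-node ts) ⟩
    suc (top k (map suc U)) ⊔ top (suc k) (map suc U)
      ≤⟨ ⊔-lub (s≤s (top-map-suc-≤ k U)) (distancesFromF-rankBounded ts k) ⟩
    suc (length U) + top k U
      ≤⟨ s≤s (+-mono-≤ (≤-reflexive (length-distancesFromF 1 ts)) (branchNumbersF-weaklyMajorizes ts k)) ⟩
    size (node ts) + top k (branchNumbersF ts)
      ≤⟨ m≤m⊔n _ (top (suc k) (branchNumbersF ts)) ⟩
    top (suc k) (branchNumbers (node ts)) ∎
    where
    open ≤-Reasoning
    U = distancesFromF 1 ts

  branchNumbersF-weaklyMajorizes : ∀ ts → WeaklyMajorizes (branchNumbersF ts) (distancesFromF 1 ts)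
  branchNumbersF-weaklyMajorizes []       k = ≤-refl
  branchNumbersF-weaklyMajorizes (t ∷ ts) =
    weaklyMajorizes-++ (branchNumbers-weaklyMajorizes t) (branchNumbersF-weaklyMajorizes ts)

theorem3p5 : (τ : Tree) → Majorizes (branchNumbers τ) (distanceNumbers τ)
theorem3p5 τ = weaklyMajorizes⇒majorizes
  (trans (length-branchNumbers τ) (sym (length-distancesFrom 1 τ)))
  (sum-branchNumbers≡sum-distanceNumbers τ)
  (branchNumbers-weaklyMajorizes τ)
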